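{- The scheme $\mathrm{Iab}_C(\varphi\wedge\psi)\rightarrow(\mathrm{Iab}_C\varphi\vee\mathrm{Iab}_C\psi)$ is not valid: there exist a finite non-empty set of agents $N$, a coalition $C\subseteq N$, formulas $\varphi,\psi$, a coalition model $\mathcal{M}$ over $N$ and a state $s$ with $\mathcal{M},s\models\mathrm{Iab}_C(\varphi\wedge\psi)$, $\mathcal{M},s\not\models\mathrm{Iab}_C\varphi$ and $\mathcal{M},s\not\models\mathrm{Iab}_C\psi$.
   Context: A coalition is any $C\subseteq N$, $\overline{C}=N\setminus C$. Formulas: $\varphi ::= p \mid \neg\varphi \mid (\varphi\wedge\psi) \mid [C]\varphi \mid \mathrm{Iab}_C\varphi$ over a countable set $\mathrm{Prop}$ of variables. A coalition model is $\mathcal{M}=(S,\{Act_i\}_{i\in N},o,V)$ with $S$ non-empty, each $Act_i$ non-empty, $o:S\times\prod_{i\in N}Act_i\to S$, $V:\mathrm{Prop}\to 2^S$; $Act_C=\prod_{i\in C}Act_i$ ($Act_\emptyset$ contains only the empty profile). $\mathcal{M},s\models[C]\varphi$ iff there is $\sigma_C\in Act_C$ such that for all $\sigma_{\overline{C}}\in Act_{\overline{C}}$, $\mathcal{M},o(s,\sigma_C,\sigma_{\overline{C}})\models\varphi$; $\mathcal{M},s\models\mathrm{Iab}_C\varphi$ iff $\mathcal{M},s\not\models[C]\varphi$; atoms and Boolean connectives as usual. -}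

module Defs where

open import Data.Nat using (ℕ; suc)
open import Data.Fin using (Fin)
open import Data.Bool using (Bool; true; false)
open import Data.Product using (Σ; ∃; _×_; _,_)
open import Relation.Binary.PropositionalEquality using (_≡_; refl)
open import Relation.Nullary using (¬_)
open import Level using (Level; _⊔_) renaming (suc to lsuc; zero to lzero)

Prop : Set
Prop = ℕ

data Formula (n : ℕ) : Set where
  var  : Prop → Formula n
  ¬'   : Formula n → Formula n
  _∧'_ : Formula n → Formula n → Formula n
  box  : (Fin n → Bool) → Formula n → Formula n
  Iab  : (Fin n → Bool) → Formula n → Formula n

-- Coalitions over N = Fin n: characteristic functions C : Fin n → Bool,
-- i ∈ C iff C i ≡ true; the complement is {i | C i ≡ false}.
Coalition : ℕ → Set
Coalition n = Fin n → Bool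

record Model (n : ℕ) : Set₁ where
  field
    S      : Set
    Act    : Fin n → Set
    act-ne : (i : Fin n) → Act i
    o      : S → ((i : Fin n) → Act i) → S
    V      : Prop → S → Set

ActC : ∀ {n} (M : Model n) → Coalition n → Set
ActC M C = (i : Fin _) → C i ≡ true → Model.Act M i

ActCbar : ∀ {n} (M : Model n) → Coalition n → Set
ActCbar M C = (i : Fin _) → C i ≡ false → Model.Act M i

combine : ∀ {n} (M : Model n) (C : Coalition n) →
          ActC M C → ActCbar M C → (i : Fin n) → Model.Act M i
combine M C σ τ i with C i in eq
... | true  = σ i eq
... | false = τ i eq

_,_⊨_ : ∀ {n} (M : Model n) → Model.S M → Formula n → Set
M , s ⊨ var p   = Model.V M p s
M , s ⊨ ¬' φ    = ¬ (M , s ⊨ φ)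
M , s ⊨ (φ ∧' ψ) = (M , s ⊨ φ) × (M , s ⊨ ψ)
M , s ⊨ box C φ = Σ (ActC M C) λ σ → (τ : ActCbar M C) →
                    M , Model.o M s (combine M C σ τ) ⊨ φ
M , s ⊨ Iab C φ = ¬ (Σ (ActC M C) λ σ → (τ : ActCbar M C) →
                    M , Model.o M s (combine M C σ τ) ⊨ φ)

-- A single agent who chooses the next state outright can force p and can
-- force q, but if p and q never hold in the same state it cannot force
-- p ∧ q: ability, unlike truth, does not distribute over conjunction.
module Submission where

open import Defs
open import Data.Nat using (ℕ; suc; zero)
open import Data.Fin using (Fin)
open import Data.Bool using (Bool; true; false)
open import Data.Product using (Σ; _×_; _,_)
open import Relation.Nullary using (¬_)
open import Relation.Binary.PropositionalEquality using (_≡_; refl)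

box⇒¬Iab : ∀ {n} (M : Model n) (s : Model.S M) (C : Coalition n) (φ : Formula n) →
           M , s ⊨ box C φ → ¬ (M , s ⊨ Iab C φ)
box⇒¬Iab M s C φ canForce cannotForce = cannotForce canForce

everyone : ∀ {n} → Coalition n
everyone _ = true

chooserValuation : Prop → Bool → Set
chooserValuation zero    b = b ≡ true
chooserValuation (suc _) b = b ≡ false

chooser : Model 1
chooser = record
  { S      = Bool
  ; Act    = λ _ → Bool
  ; act-ne = λ _ → true
  ; o      = λ _ σ → σ Fin.zero
  ; V      = chooserValuation
  }

noOpponents : ActCbar chooser everyone
noOpponents _ ()

chooser-forces : ∀ s b p → chooserValuation p b →
                 chooser , s ⊨ box everyone (var p)
chooser-forces s b p holds = (λ _ _ → b) , λ _ → holds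

chooser-cannot-force-both : ∀ s → chooser , s ⊨ Iab everyone (var 0 ∧' var 1)
chooser-cannot-force-both s (σ , outcome) = disjoint (σ Fin.zero refl) (outcome noOpponents)
  where
  disjoint : ∀ b → ¬ ((b ≡ true) × (b ≡ false))
  disjoint true  (_ , ())
  disjoint false (() , _)

proposition4p10 : Σ ℕ λ k → Σ (Coalition (suc k)) λ C → Σ (Formula (suc k)) λ φ →
    Σ (Formula (suc k)) λ ψ → Σ (Model (suc k)) λ M → Σ (Model.S M) λ s →
    (M , s ⊨ Iab C (φ ∧' ψ)) × ¬ (M , s ⊨ Iab C φ) × ¬ (M , s ⊨ Iab C ψ)
proposition4p10 = 0 , everyone , var 0 , var 1 , chooser , true ,
  chooser-cannot-force-both true ,
  box⇒¬Iab chooser true everyone (var 0) (chooser-forces true true 0 refl) ,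
  box⇒¬Iab chooser true everyone (var 1) (chooser-forces true false 1 refl)
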